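{- Let $\mathcal{M}=(E,\mathcal{L})$ be a simple oriented matroid with topes $\mathcal{T}$, let $X\in L(\mathcal{M})$, and let $\rho_X:\mathcal{L}^\vee\to\mathcal{L}_X^\vee$, $\tau\mapsto\tau|_X$. For $\sigma\in\mathcal{L}_X^\vee$, the set $\mathcal{T}(\rho_X\downarrow\sigma)=\{T\in\mathcal{T}\mid \rho_X(T)\le_{\mathcal{L}_X^\vee}\sigma\}$ of topes in the poset fiber $(\rho_X\downarrow\sigma)$ is a convex subset of $\mathcal{T}$.
   Context: For sign vectors: $(\sigma\circ\tau)_e=\sigma_e$ if $\sigma_e\ne0$, else $\tau_e$; $S(\sigma,\tau)=\{e\mid\sigma_e=-\tau_e\ne0\}$; $z(\sigma)=\{e\mid\sigma_e=0\}$. An oriented matroid $\mathcal{M}=(E,\mathcal{L})$ is a finite $E$ with $\mathcal{L}\subseteq\{+,-,0\}^E$ such that $\mathbf0\in\mathcal{L}$, $-\mathcal{L}=\mathcal{L}$, $\mathcal{L}$ closed under $\circ$, and for $\sigma,\tau\in\mathcal{L}$, $e\in S(\sigma,\tau)$ there is $\eta\in\mathcal{L}$ with $\eta_e=0$, $\eta_f=(\sigma\circ\tau)_f=(\tau\circ\sigma)_f$ for $f\notin S(\sigma,\tau)$. Simple: no loops, no parallel pairs. $\mathcal{L}$ is ordered componentwise ($0<+,0<-$), topes are maximal elements; $\mathcal{L}^\vee$ denotes the dual (opposite) poset. Flats $L(\mathcal{M})=\{z(\sigma)\}$. $\mathcal{L}_X=\{\tau|_X\mid\tau\in\mathcal{L}\}$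 with componentwise order, and $\mathcal{L}_X^\vee$ its dual. The poset fiber of an order preserving map $f:P\to Q$ at $q$ is $f^{ -1}(Q_{\le q})$. Halfspaces are $\mathcal{T}_e^\epsilon=\{T\mid T_e=\epsilon\}$ for $e\in E$, $\epsilon\in\{+,-\}$; $\mathcal{Q}\subseteq\mathcal{T}$ is convex if it equals the intersection of all halfspaces containing it. -}

module Defs where

open import Level using (Level; suc; _⊔_)
open import Data.Nat using (ℕ)
open import Data.Fin using (Fin)
open import Data.Fin.Subset using (Subset; _∈_)
open import Data.Product using (Σ; _×_; _,_; ∃; ∃-syntax)
open import Data.Sum using (_⊎_)
open import Relation.Binary.PropositionalEquality using (_≡_; _≢_)
open import Relation.Nullary using (¬_)
open import Function.Bundles using (_⇔_)

data Sign : Set where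
  plus minus zer : Sign

neg : Sign → Sign
neg plus = minus
neg minus = plus
neg zer = zer

data _≤ˢ_ : Sign → Sign → Set where
  0≤ : ∀ {s} → zer ≤ˢ s
  ≤refl : ∀ {s} → s ≤ˢ s

SignVec : ℕ → Set
SignVec n = Fin n → Sign

module _ {n : ℕ} where

  negV : SignVec n → SignVec n
  negV σ e = neg (σ e)

  _∘ˢ_ : SignVec n → SignVec n → SignVec n
  (σ ∘ˢ τ) e with σ e
  ... | zer = τ e
  ... | s = s

  Sep : SignVec n → SignVec n → Fin n → Set
  Sep σ τ e = (σ e ≡ neg (τ e)) × (σ e ≢ zer)

  zeroVec : SignVec n
  zeroVec e = zer

  _≤ⱽ_ : SignVec n → SignVec n → Set
  σ ≤ⱽ τ = ∀ e → σ e ≤ˢ τ e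

  -- Oriented matroid given by its set of covectors ℒ (as a predicate)
  record IsOrientedMatroid {ℓ : Level} (ℒ : SignVec n → Set ℓ) : Set ℓ where
    field
      zero∈   : ℒ zeroVec
      neg∈    : ∀ σ → ℒ σ → ℒ (negV σ)
      comp∈   : ∀ σ τ → ℒ σ → ℒ τ → ℒ (σ ∘ˢ τ)
      elim    : ∀ σ τ → ℒ σ → ℒ τ → ∀ e → Sep σ τ e →
                Σ (SignVec n) λ η → ℒ η × (η e ≡ zer) ×
                  (∀ f → ¬ Sep σ τ f →
                     (η f ≡ (σ ∘ˢ τ) f) × (η f ≡ (τ ∘ˢ σ) f))

  IsLoop : {ℓ : Level} → (SignVec n → Set ℓ) → Fin n → Set ℓ
  IsLoop ℒ e = ∀ σ → ℒ σ → σ e ≡ zer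

  Parallel : {ℓ : Level} → (SignVec n → Set ℓ) → Fin n → Fin n → Set ℓ
  Parallel ℒ e f = (e ≢ f) ×
    ((∀ σ → ℒ σ → σ e ≡ σ f) ⊎ (∀ σ → ℒ σ → σ e ≡ neg (σ f)))

  IsSimple : {ℓ : Level} → (SignVec n → Set ℓ) → Set ℓ
  IsSimple ℒ = (∀ e → ¬ IsLoop ℒ e) × (∀ e f → ¬ Parallel ℒ e f)

  IsTope : {ℓ : Level} → (SignVec n → Set ℓ) → SignVec n → Set ℓ
  IsTope ℒ T = ℒ T × (∀ τ → ℒ τ → T ≤ⱽ τ → ∀ e → T e ≡ τ e)

  IsFlat : {ℓ : Level} → (SignVec n → Set ℓ) → Subset n → Set ℓ
  IsFlat ℒ X = Σ (SignVec n) λ σ → ℒ σ × (∀ e → (e ∈ X) ⇔ (σ e ≡ zer))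

  _≤[_]_ : SignVec n → Subset n → SignVec n → Set
  σ ≤[ X ] τ = ∀ e → e ∈ X → σ e ≤ˢ τ e

  -- Topes of the poset fiber (ρ_X ↓ σ|_X):  T with ρ_X(T) ≤ σ|_X in ℒ_X^∨,
  -- i.e. σ|_X ≤ T|_X in ℒ_X.
  FiberTopes : {ℓ : Level} → (SignVec n → Set ℓ) → Subset n → SignVec n → SignVec n → Set ℓ
  FiberTopes ℒ X σ T = IsTope ℒ T × (σ ≤[ X ] T)

  -- Convexity of a set of topes 𝒬 ⊆ 𝒯: 𝒬 equals the intersection (inside 𝒯)
  -- of all halfspaces 𝒯_e^ε (ε ∈ {+,-}) containing 𝒬.
  IsConvex : {ℓ ℓ' : Level} → (SignVec n → Set ℓ) → (SignVec n → Set ℓ') → Set (ℓ ⊔ ℓ')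
  IsConvex ℒ 𝒬 =
    (∀ T → 𝒬 T → IsTope ℒ T) ×
    (∀ T → 𝒬 T ⇔ (IsTope ℒ T ×
       (∀ e ε → ε ≢ zer → (∀ Q → 𝒬 Q → Q e ≡ ε) → T e ≡ ε)))

-- A tope T lies in the fiber iff T e = σ e for every e ∈ X with σ e ≠ 0.
-- Each such condition is a halfspace containing the fiber, so any tope in all
-- halfspaces containing the fiber satisfies them and lies in the fiber.
module Submission where

open import Defs
open import Level using (Level)
open import Data.Nat using (ℕ)
open import Data.Fin.Subset using (Subset; _∈_)
open import Data.Product using (_×_; _,_; proj₁)
open import Function.Bundles using (mk⇔)
open import Relation.Binary.PropositionalEquality using (_≡_; refl; _≢_)
open import Data.Empty using (⊥-elim)

≤ˢ-nonzero⇒≡ : ∀ {s t} → s ≤ˢ t → s ≢ zer → t ≡ s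
≤ˢ-nonzero⇒≡ 0≤     s≢0 = ⊥-elim (s≢0 refl)
≤ˢ-nonzero⇒≡ ≤refl _   = refl

≤ˢ-intro : ∀ s t → (∀ ε → ε ≢ zer → s ≡ ε → t ≡ ε) → s ≤ˢ t
≤ˢ-intro zer   t _ = 0≤
≤ˢ-intro plus  t h with h plus (λ ()) refl
... | refl = ≤refl
≤ˢ-intro minus t h with h minus (λ ()) refl
... | refl = ≤refl

module _ {n : ℕ} {ℓ : Level} (ℒ : SignVec n → Set ℓ) (X : Subset n) (σ : SignVec n) where

  fiber-in-halfspace : ∀ {e} → e ∈ X → σ e ≢ zer →
                       ∀ Q → FiberTopes ℒ X σ Q → Q e ≡ σ e
  fiber-in-halfspace e∈X σe≢0 Q (_ , σ≤Q) = ≤ˢ-nonzero⇒≡ (σ≤Q _ e∈X) σe≢0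

  fiberTopes-isConvex : IsConvex ℒ (FiberTopes ℒ X σ)
  fiberTopes-isConvex = (λ _ → proj₁) , λ T → mk⇔ (fiber⊆hull T) (hull⊆fiber T)
    where
    InHull : SignVec n → Set ℓ
    InHull T = IsTope ℒ T ×
      (∀ e ε → ε ≢ zer → (∀ Q → FiberTopes ℒ X σ Q → Q e ≡ ε) → T e ≡ ε)

    fiber⊆hull : ∀ T → FiberTopes ℒ X σ T → InHull T
    fiber⊆hull T q = proj₁ q , λ _ _ _ inHalfspace → inHalfspace T q

    hull⊆fiber : ∀ T → InHull T → FiberTopes ℒ X σ T
    hull⊆fiber T (isTope , inHulls) = isTope , λ e e∈X → ≤ˢ-intro (σ e) (T e) λ where
      ε ε≢0 refl → inHulls e ε ε≢0 (fiber-in-halfspace e∈X ε≢0)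

lemma2p19 : {ℓ : Level} (n : ℕ) (ℒ : SignVec n → Set ℓ) →
    IsOrientedMatroid ℒ → IsSimple ℒ →
    (X : Subset n) → IsFlat ℒ X →
    (σ : SignVec n) → ℒ σ →
    IsConvex ℒ (FiberTopes ℒ X σ)
-- Convexity holds for every sign vector σ and subset X.
lemma2p19 n ℒ _ _ X _ σ _ = fiberTopes-isConvex ℒ X σ
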